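{- Let $\Gamma=K_{6,6}$ and let $G\leqslant\mathrm{Aut}(\Gamma)$ be transitive on vertices and edges with $G^+=\mathrm{Diag}_\varphi(H\times H)$, where $H=\mathrm{Alt}(6)$ or $\mathrm{Sym}(6)$ and $\varphi$ is a chosen outer automorphism of $\mathrm{Sym}(6)$ of order $2$. Then $D(G)=3$.
   Context: $D(G)$ is the smallest $k$ such that there is a partition of the vertex set into $k$ parts whose setwise stabilisers in $G$ intersect trivially. The parts are $\Delta=\{v_1,\dots,v_6\}$, $\Delta'=\{u_1,\dots,u_6\}$; $(g,g')\in\mathrm{Sym}(6)\times\mathrm{Sym}(6)$ acts by $v_i\mapsto v_{i^g}$, $u_i\mapsto u_{i^{g'}}$. $G^+$ is the index-two subgroup of $G$ preserving each part, and $\mathrm{Diag}_\varphi(H\times H)=\{(h,h^\varphi):h\in H\}$. -}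

module Defs where

open import Data.Nat using (ℕ; _<_)
open import Data.Nat.Divisibility using (_∣_)
open import Data.Bool using (Bool; true; false; if_then_else_; _∧_)
open import Data.Fin using (Fin; _<?_)
open import Data.Fin.Permutation using (Permutation′; _⟨$⟩ʳ_; _∘ₚ_; flip)
open import Data.List using (map; allFin)
open import Data.Nat.ListAction using (sum)
open import Data.Sum using (_⊎_; inj₁; inj₂)
open import Data.Product using (_×_; _,_; Σ; ∃; ∃-syntax)
open import Data.Unit using (⊤)
open import Data.Empty using (⊥)
open import Function.Bundles using (_↔_; Inverse)
open import Function.Definitions using (Surjective)
open import Relation.Nullary using (¬_)
open import Relation.Nullary.Decidable using (isYes)
open import Relation.Binary.PropositionalEquality using (_≡_)

Perm6 : Set
Perm6 = Permutation′ 6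

_≈ₚ_ : Perm6 → Perm6 → Set
π ≈ₚ σ = ∀ i → π ⟨$⟩ʳ i ≡ σ ⟨$⟩ʳ i

inversions : Perm6 → ℕ
inversions π =
  sum (map (λ i → sum (map (λ j →
        if isYes (i <? j) ∧ isYes ((π ⟨$⟩ʳ j) <? (π ⟨$⟩ʳ i)) then 1 else 0)
      (allFin 6))) (allFin 6))

Even : Perm6 → Set
Even π = 2 ∣ inversions π

data HChoice : Set where
  alt sym : HChoice

HSub : HChoice → Perm6 → Set
HSub alt π = Even π
HSub sym π = ⊤

-- φ is an automorphism of Sym(6) (well-defined, homomorphic; bijectivity
-- follows from φ ∘ φ = id), of order 2, and not inner.
record OuterInvolution (φ : Perm6 → Perm6) : Set where
  field
    φ-cong  : ∀ π σ → π ≈ₚ σ → φ π ≈ₚ φ σ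
    φ-hom   : ∀ π σ → φ (π ∘ₚ σ) ≈ₚ (φ π ∘ₚ φ σ)
    φ-invol : ∀ π → φ (φ π) ≈ₚ π
    φ-outer : ¬ (Σ Perm6 λ τ → ∀ π → φ π ≈ₚ ((flip τ ∘ₚ π) ∘ₚ τ))

-- The graph K_{6,6}: vertices v_i = inj₁ i (Δ) and u_i = inj₂ i (Δ')

V : Set
V = Fin 6 ⊎ Fin 6

Adj : V → V → Set
Adj (inj₁ _) (inj₁ _) = ⊥
Adj (inj₁ _) (inj₂ _) = ⊤
Adj (inj₂ _) (inj₁ _) = ⊤
Adj (inj₂ _) (inj₂ _) = ⊥

side : V → Bool
side (inj₁ _) = true
side (inj₂ _) = false

record AutΓ : Set where
  field
    perm : V ↔ V
    adj⇒ : ∀ v w → Adj v w → Adj (Inverse.to perm v) (Inverse.to perm w)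
    adj⇐ : ∀ v w → Adj (Inverse.to perm v) (Inverse.to perm w) → Adj v w

app : AutΓ → V → V
app g = Inverse.to (AutΓ.perm g)

record IsSubgroup (G : AutΓ → Set) : Set where
  field
    has-id  : Σ AutΓ λ e → G e × (∀ v → app e v ≡ v)
    has-∘   : ∀ g h → G g → G h →
              Σ AutΓ λ k → G k × (∀ v → app k v ≡ app g (app h v))
    has-inv : ∀ g → G g → Σ AutΓ λ k → G k × (∀ v → app k (app g v) ≡ v)

VertexTransitive : (AutΓ → Set) → Set
VertexTransitive G = ∀ v w → Σ AutΓ λ g → G g × app g v ≡ w

MapsEdge : AutΓ → V → V → V → V → Set
MapsEdge g a b c d = (app g a ≡ c × app g b ≡ d) ⊎ (app g a ≡ d × app g b ≡ c)

EdgeTransitive : (AutΓ → Set) → Set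
EdgeTransitive G = ∀ a b c d → Adj a b → Adj c d →
  Σ AutΓ λ g → G g × MapsEdge g a b c d

PreservesParts : AutΓ → Set
PreservesParts g = ∀ v → side (app g v) ≡ side v

ActsAs : (Perm6 → Perm6) → AutΓ → Perm6 → Set
ActsAs φ g h = ∀ i → app g (inj₁ i) ≡ inj₁ (h ⟨$⟩ʳ i)
                   × app g (inj₂ i) ≡ inj₂ (φ h ⟨$⟩ʳ i)

PlusIsDiag : (AutΓ → Set) → (Perm6 → Perm6) → (Perm6 → Set) → Set
PlusIsDiag G φ H =
  (∀ g → G g → PreservesParts g → Σ Perm6 λ h → H h × ActsAs φ g h)
  × (∀ h → H h → Σ AutΓ λ g → G g × ActsAs φ g h)

-- a partition of V into k (nonempty) parts, given as a surjection V → Fin k;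
-- it is distinguishing if the only element of G fixing every part setwise
-- is the identity
Distinguishing : (AutΓ → Set) → {k : ℕ} → (V → Fin k) → Set
Distinguishing G c = ∀ g → G g → (∀ v → c (app g v) ≡ c v) → ∀ v → app g v ≡ v

HasDistPartition : (AutΓ → Set) → ℕ → Set
HasDistPartition G k = Σ (V → Fin k) λ c → Surjective _≡_ _≡_ c × Distinguishing G c

DistNumberIs : (AutΓ → Set) → ℕ → Set
DistNumberIs G k = HasDistPartition G k × (∀ m → m < k → ¬ HasDistPartition G m)

-- An automorphism φ of Sym(6) is determined by the images of the Coxeter
-- generators sᵢ = (i i+1), which are nontrivial involutions satisfying the
-- Coxeter relations of type A₅. Enumerating all such families shows that, up to
-- conjugation by some ρ, they are either the sᵢ themselves or the images ψ(sᵢ)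
-- under one fixed outer automorphism ψ; transported along ρ, G⁺ acts on
-- Δ ⊎ Δ′ as h ↦ (h, h) or h ↦ (h, ψ(h)). In both models, for any 2-colourings
-- of Δ and Δ′ some 3-cycle or double transposition h preserves the first while
-- its image preserves the second, so D(G) > 2. Conversely, colour the pairs
-- {0,1}, {2,3}, {4,5} of Δ with three colours: colour 2 forces g ∈ G to preserve
-- the parts, h must then lie in ⟨s₀, s₂, s₄⟩, and a suitable 2-colouring of Δ′
-- is moved by the image of each of its 7 nontrivial elements, so D(G) ≤ 3.
module Submission where

open import Defs hiding (sym)
open import Data.Bool using (true; false; if_then_else_)
open import Data.Bool.Properties using (T-≡)
open import Data.Empty using (⊥; ⊥-elim)
open import Data.Fin using (Fin; zero; suc; #_; inject₁; inject≤; toℕ; _<?_)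
open import Data.Fin.Properties using (_≟_; inject≤-injective; all?)
open import Data.Fin.Permutation
  using (_⟨$⟩ʳ_; _⟨$⟩ˡ_; _∘ₚ_; transpose; permutation; flip; inverseˡ; inverseʳ)
  renaming (id to idₚ)
import Data.List as List
open import Data.List
  using (List; []; _∷_; [_]; _++_; concatMap; filter; cartesianProduct; cartesianProductWith)
open import Data.List.Membership.Propositional using (_∈_; lose; find)
open import Data.List.Membership.Propositional.Properties
  using (∈-allFin; ∈-cartesianProductWith⁺; ∈-concatMap⁺; ∈-filter⁺; ∈-filter⁻; ∈-map⁺)
import Data.List.Relation.Unary.All as All
open All using (All)
import Data.List.Relation.Unary.Any as Any
open Any using (Any)
import Data.List.Relation.Unary.Any.Properties as Anyₚ
open import Data.Maybe using (fromMaybe)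
open import Data.Nat using (ℕ; zero; suc; _+_; s≤s⁻¹)
open import Data.Nat.Divisibility using (_∣?_)
open import Data.Product using (Σ; ∃; _×_; _,_; proj₁; proj₂)
open import Data.Sum using (inj₁; inj₂)
open import Data.Sum.Properties using (inj₁-injective)
open import Data.Unit using (⊤; tt)
open import Data.Vec using (Vec; []; _∷_; lookup; map; tabulate; allFin; replicate)
  renaming (_++_ to _++ᵥ_)
import Data.Vec.Relation.Unary.All as Allᵥ
open import Data.Vec.Relation.Unary.All.Properties using (map⁺; map⁻; lookup⁺)
open import Data.Vec.Properties
  using ( ≡-dec; lookup-map; lookup∘tabulate; tabulate∘lookup; tabulate-cong; lookup-allFin
        ; lookup-replicate)
open import Function using (_∘_; id; Equivalence)
open import Function.Definitions using (Surjective)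
open import Relation.Binary using (DecidableEquality)
open import Relation.Binary.PropositionalEquality
  using (_≡_; _≢_; refl; sym; trans; cong; cong₂; subst; module ≡-Reasoning)
open import Relation.Nullary using (Dec; yes; ¬_; ¬?)
open import Relation.Nullary.Decidable using (isYes; toWitness; _×-dec_; _→-dec_)

by-evaluation : {A : Set} (a? : Dec A) → isYes a? ≡ true → A
by-evaluation a? eq = toWitness (Equivalence.from T-≡ eq)

choices : {A : Set} {n : ℕ} → Vec (List A) n → List (Vec A n)
choices []         = [ [] ]
choices (xs ∷ xss) = cartesianProductWith _∷_ xs (choices xss)

∈-choices : {A : Set} {n : ℕ} (v : Vec A n) (xss : Vec (List A) n) →
            (∀ i → lookup v i ∈ lookup xss i) → v ∈ choices xss
∈-choices []      []         _ = Any.here refl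
∈-choices (x ∷ v) (xs ∷ xss) h = ∈-cartesianProductWith⁺ _∷_ (h zero) (∈-choices v xss (h ∘ suc))

vectors : {k : ℕ} (n : ℕ) → List (Vec (Fin k) n)
vectors {k} n = choices (replicate n (List.allFin k))

∈-vectors : {k n : ℕ} (v : Vec (Fin k) n) → v ∈ vectors n
∈-vectors {k} {n} v = ∈-choices v (replicate n (List.allFin k)) λ i →
  subst (lookup v i ∈_) (sym (lookup-replicate i (List.allFin k))) (∈-allFin (lookup v i))

filter⁻ : {A : Set} {P Q : A → Set} (Q? : ∀ x → Dec (Q x)) {xs : List A} →
          Any P (filter Q? xs) → Any (λ x → P x × Q x) xs
filter⁻ Q? p =
  let x , x∈ , px = find p
      x∈xs , qx   = ∈-filter⁻ Q? x∈
  in lose x∈xs (px , qx)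

Table : Set
Table = Vec (Fin 6) 6

infixr 7 _·_
infix 4 _≟ᵛ_

-- t · c is c ∘ t: on tables, first t, then c
_·_ : {A : Set} {n : ℕ} → Vec (Fin 6) n → Vec A 6 → Vec A n
t · c = map (lookup c) t

ι : Table
ι = allFin 6

_≟ᵛ_ : {k n : ℕ} → DecidableEquality (Vec (Fin k) n)
_≟ᵛ_ = ≡-dec _≟_

lookup-· : {A : Set} {n : ℕ} (t : Vec (Fin 6) n) (c : Vec A 6) (i : Fin n) →
           lookup (t · c) i ≡ lookup c (lookup t i)
lookup-· t c i = lookup-map i (lookup c) t

lookup-ext : {A : Set} {n : ℕ} {u v : Vec A n} → (∀ i → lookup u i ≡ lookup v i) → u ≡ v
lookup-ext {u = u} {v} h =
  trans (sym (tabulate∘lookup u)) (trans (tabulate-cong h) (tabulate∘lookup v))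

inverse-lookup : (t u : Table) → t · u ≡ ι → ∀ x → lookup u (lookup t x) ≡ x
inverse-lookup t u eq x =
  trans (sym (lookup-· t u x)) (trans (cong (λ v → lookup v x) eq) (lookup-allFin x))

-- Computed tables and lists, and the certificates obtained by evaluation, are
-- abstract: otherwise the type checker may evaluate them while comparing types.
abstract
  invert : Table → Table
  invert r = tabulate λ y →
    List.foldr (λ x z → if isYes (lookup r x ≟ y) then x else z) zero (List.allFin 6)

Bijective : Table → Set
Bijective r = r · invert r ≡ ι × invert r · r ≡ ι

bijective? : (r : Table) → Dec (Bijective r)
bijective? r = (r · invert r ≟ᵛ ι) ×-dec (invert r · r ≟ᵛ ι)

toPerm : (r : Table) → Bijective r → Perm6
toPerm r (rr⁻¹ , r⁻¹r) = permutation (lookup r) (lookup (invert r))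
  (inverse-lookup (invert r) r r⁻¹r) (inverse-lookup r (invert r) rr⁻¹)

reify : Perm6 → Table
reify π = tabulate (π ⟨$⟩ʳ_)

lookup-reify : (π : Perm6) (i : Fin 6) → lookup (reify π) i ≡ π ⟨$⟩ʳ i
lookup-reify π = lookup∘tabulate (π ⟨$⟩ʳ_)

reify-cong : {π ρ : Perm6} → π ≈ₚ ρ → reify π ≡ reify ρ
reify-cong = tabulate-cong

reify-injective : {π ρ : Perm6} → reify π ≡ reify ρ → π ≈ₚ ρ
reify-injective {π} {ρ} eq i =
  trans (sym (lookup-reify π i)) (trans (cong (λ t → lookup t i) eq) (lookup-reify ρ i))

reify-∘ : (π ρ : Perm6) → reify (π ∘ₚ ρ) ≡ reify π · reify ρ
reify-∘ π ρ = lookup-ext λ i → begin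
  lookup (reify (π ∘ₚ ρ)) i               ≡⟨ lookup-reify (π ∘ₚ ρ) i ⟩
  ρ ⟨$⟩ʳ (π ⟨$⟩ʳ i)                        ≡⟨ sym (lookup-reify ρ (π ⟨$⟩ʳ i)) ⟩
  lookup (reify ρ) (π ⟨$⟩ʳ i)              ≡⟨ cong (lookup (reify ρ)) (sym (lookup-reify π i)) ⟩
  lookup (reify ρ) (lookup (reify π) i)    ≡⟨ sym (lookup-· (reify π) (reify ρ) i) ⟩
  lookup (reify π · reify ρ) i             ∎
  where open ≡-Reasoning

reify-∘₃ : (π ρ κ : Perm6) → reify (π ∘ₚ ρ ∘ₚ κ) ≡ reify π · reify ρ · reify κ
reify-∘₃ π ρ κ = trans (reify-∘ π (ρ ∘ₚ κ)) (cong (reify π ·_) (reify-∘ ρ κ))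

record IsMonomorphism (f : Perm6 → Perm6) : Set where
  field
    resp-≈    : {π ρ : Perm6} → π ≈ₚ ρ → f π ≈ₚ f ρ
    homo      : (π ρ : Perm6) → f (π ∘ₚ ρ) ≈ₚ (f π ∘ₚ f ρ)
    injective : {π ρ : Perm6} → f π ≈ₚ f ρ → π ≈ₚ ρ

  -- f idₚ is an idempotent permutation
  identity : f idₚ ≈ₚ idₚ
  identity i = begin
    e ⟨$⟩ʳ i                    ≡⟨ sym (inverseˡ e) ⟩
    e ⟨$⟩ˡ (e ⟨$⟩ʳ (e ⟨$⟩ʳ i))  ≡⟨ cong (e ⟨$⟩ˡ_) (trans (sym (homo idₚ idₚ i))
                                     (resp-≈ {idₚ ∘ₚ idₚ} {idₚ} (λ _ → refl) i)) ⟩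
    e ⟨$⟩ˡ (e ⟨$⟩ʳ i)           ≡⟨ inverseˡ e ⟩
    i                           ∎
    where
    open ≡-Reasoning
    e = f idₚ

id-monomorphism : IsMonomorphism id
id-monomorphism = record { resp-≈ = id ; homo = λ _ _ _ → refl ; injective = id }

outerInvolution⇒monomorphism : {φ : Perm6 → Perm6} → OuterInvolution φ → IsMonomorphism φ
outerInvolution⇒monomorphism {φ} oi = record
  { resp-≈    = φ-cong _ _
  ; homo      = φ-hom
  ; injective = λ {π} {ρ} eq j →
      trans (sym (φ-invol π j)) (trans (φ-cong (φ π) (φ ρ) eq j) (φ-invol ρ j))
  }
  where open OuterInvolution oi

conjugate : Perm6 → Perm6 → Perm6
conjugate ξ π = ξ ∘ₚ π ∘ₚ flip ξ

⟨$⟩ˡ-injective : (ξ : Perm6) {a b : Fin 6} → ξ ⟨$⟩ˡ a ≡ ξ ⟨$⟩ˡ b → a ≡ b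
⟨$⟩ˡ-injective ξ eq = trans (sym (inverseʳ ξ)) (trans (cong (ξ ⟨$⟩ʳ_) eq) (inverseʳ ξ))

conjugate-monomorphism : {f : Perm6 → Perm6} (ξ : Perm6) →
                         IsMonomorphism f → IsMonomorphism (conjugate ξ ∘ f)
conjugate-monomorphism {f} ξ mono = record
  { resp-≈    = λ eq i → cong (ξ ⟨$⟩ˡ_) (resp-≈ eq (ξ ⟨$⟩ʳ i))
  ; homo      = λ π ρ i → cong (ξ ⟨$⟩ˡ_)
                  (trans (homo π ρ (ξ ⟨$⟩ʳ i)) (cong (f ρ ⟨$⟩ʳ_) (sym (inverseʳ ξ))))
  ; injective = λ {π} {ρ} eq → injective (unconjugate {f π} {f ρ} eq)
  }
  where
  open IsMonomorphism mono
  open ≡-Reasoning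
  unconjugate : {π ρ : Perm6} → conjugate ξ π ≈ₚ conjugate ξ ρ → π ≈ₚ ρ
  unconjugate {π} {ρ} eq i = begin
    π ⟨$⟩ʳ i                      ≡⟨ cong (π ⟨$⟩ʳ_) (sym (inverseʳ ξ)) ⟩
    π ⟨$⟩ʳ (ξ ⟨$⟩ʳ (ξ ⟨$⟩ˡ i))   ≡⟨ ⟨$⟩ˡ-injective ξ (eq (ξ ⟨$⟩ˡ i)) ⟩
    ρ ⟨$⟩ʳ (ξ ⟨$⟩ʳ (ξ ⟨$⟩ˡ i))   ≡⟨ cong (ρ ⟨$⟩ʳ_) (inverseʳ ξ) ⟩
    ρ ⟨$⟩ʳ i                      ∎

-- Words and Coxeter relations

⟦_⟧ₚ : {n : ℕ} → List (Fin n) → Vec Perm6 n → Perm6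
⟦ w ⟧ₚ gs = List.foldr (λ i π → lookup gs i ∘ₚ π) idₚ w

⟦_⟧ : {n : ℕ} → List (Fin n) → Vec Table n → Table
⟦ w ⟧ ts = List.foldr (λ i t → lookup ts i · t) ι w

Intertwines : {n : ℕ} → (Fin 6 → Fin 6) → Vec Table n → Vec Table n → Set
Intertwines r T P = ∀ i y → lookup (lookup T i) (r y) ≡ r (lookup (lookup P i) y)

intertwines-⟦⟧ : {n : ℕ} {r : Fin 6 → Fin 6} {T P : Vec Table n} → Intertwines r T P →
                 ∀ w y → lookup (⟦ w ⟧ T) (r y) ≡ r (lookup (⟦ w ⟧ P) y)
intertwines-⟦⟧ {r = r} h [] y = trans (lookup-allFin (r y)) (cong r (sym (lookup-allFin y)))
intertwines-⟦⟧ {r = r} {T} {P} h (i ∷ w) y = begin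
  lookup (Tᵢ · ⟦ w ⟧ T) (r y)          ≡⟨ lookup-· Tᵢ (⟦ w ⟧ T) (r y) ⟩
  lookup (⟦ w ⟧ T) (lookup Tᵢ (r y))   ≡⟨ cong (lookup (⟦ w ⟧ T)) (h i y) ⟩
  lookup (⟦ w ⟧ T) (r (lookup Pᵢ y))   ≡⟨ intertwines-⟦⟧ {r = r} {T} {P} h w (lookup Pᵢ y) ⟩
  r (lookup (⟦ w ⟧ P) (lookup Pᵢ y))   ≡⟨ cong r (sym (lookup-· Pᵢ (⟦ w ⟧ P) y)) ⟩
  r (lookup (Pᵢ · ⟦ w ⟧ P) y)          ∎
  where
  open ≡-Reasoning
  Tᵢ = lookup T i
  Pᵢ = lookup P i

Involution : Table → Set
Involution t = t · t ≡ ι × t ≢ ι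

Braid : Table → Table → Set
Braid t u = t · u · t ≡ u · t · u × t ≢ u

Commute : Table → Table → Set
Commute t u = t · u ≡ u · t

Compatible : {n : ℕ} → Table → Vec Table n → Set
Compatible t []       = ⊤
Compatible t (u ∷ us) = Braid t u × Allᵥ.All (Commute t) us

Coxeter : {n : ℕ} → Vec Table n → Set
Coxeter []       = ⊤
Coxeter (t ∷ ts) = Compatible t ts × Coxeter ts

involution? : (t : Table) → Dec (Involution t)
involution? t = (t · t ≟ᵛ ι) ×-dec ¬? (t ≟ᵛ ι)

compatible? : {n : ℕ} (t : Table) (ts : Vec Table n) → Dec (Compatible t ts)
compatible? t []       = yes tt
compatible? t (u ∷ us) =
  ((t · u · t ≟ᵛ u · t · u) ×-dec ¬? (t ≟ᵛ u)) ×-dec Allᵥ.all? (λ u → t · u ≟ᵛ u · t) us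

coxeter? : {n : ℕ} (ts : Vec Table n) → Dec (Coxeter ts)
coxeter? []       = yes tt
coxeter? (t ∷ ts) = compatible? t ts ×-dec coxeter? ts

module Image {f : Perm6 → Perm6} (mono : IsMonomorphism f) where
  open IsMonomorphism mono
  open ≡-Reasoning

  image : Perm6 → Table
  image = reify ∘ f

  image-id : image idₚ ≡ ι
  image-id = reify-cong {f idₚ} {idₚ} identity

  image-∘ : (π ρ : Perm6) → image (π ∘ₚ ρ) ≡ image π · image ρ
  image-∘ π ρ = trans (reify-cong {f (π ∘ₚ ρ)} {f π ∘ₚ f ρ} (homo π ρ)) (reify-∘ (f π) (f ρ))

  image-∘₃ : (π ρ κ : Perm6) → image (π ∘ₚ ρ ∘ₚ κ) ≡ image π · image ρ · image κ
  image-∘₃ π ρ κ = trans (image-∘ π (ρ ∘ₚ κ)) (cong (image π ·_) (image-∘ ρ κ))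

  image-⟦⟧ : {n : ℕ} (w : List (Fin n)) (gs : Vec Perm6 n) →
             image (⟦ w ⟧ₚ gs) ≡ ⟦ w ⟧ (map image gs)
  image-⟦⟧ []      gs = image-id
  image-⟦⟧ (i ∷ w) gs = trans (image-∘ (lookup gs i) (⟦ w ⟧ₚ gs))
                               (cong₂ _·_ (sym (lookup-map i image gs)) (image-⟦⟧ w gs))

  image-≡ : (π ρ : Perm6) → reify π ≡ reify ρ → image π ≡ image ρ
  image-≡ π ρ eq = reify-cong {f π} {f ρ} (resp-≈ (reify-injective {π} {ρ} eq))

  image-≢ : (π ρ : Perm6) → reify π ≢ reify ρ → image π ≢ image ρ
  image-≢ π ρ ne eq = ne (reify-cong {π} {ρ} (injective (reify-injective {f π} {f ρ} eq)))

  involution : {π : Perm6} → Involution (reify π) → Involution (image π)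
  involution {π} (square , nontrivial) =
    (begin
      image π · image π   ≡⟨ sym (image-∘ π π) ⟩
      image (π ∘ₚ π)      ≡⟨ image-≡ (π ∘ₚ π) idₚ (trans (reify-∘ π π) square) ⟩
      image idₚ           ≡⟨ image-id ⟩
      ι                   ∎)
    , λ eq → image-≢ π idₚ nontrivial (trans eq (sym image-id))

  braid : {π ρ : Perm6} → Braid (reify π) (reify ρ) → Braid (image π) (image ρ)
  braid {π} {ρ} (eq , ne) =
    (begin
      image π · image ρ · image π   ≡⟨ sym (image-∘₃ π ρ π) ⟩
      image (π ∘ₚ ρ ∘ₚ π)           ≡⟨ image-≡ (π ∘ₚ ρ ∘ₚ π) (ρ ∘ₚ π ∘ₚ ρ)
                                         (trans (reify-∘₃ π ρ π)
                                           (trans eq (sym (reify-∘₃ ρ π ρ)))) ⟩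
      image (ρ ∘ₚ π ∘ₚ ρ)           ≡⟨ image-∘₃ ρ π ρ ⟩
      image ρ · image π · image ρ   ∎)
    , image-≢ π ρ ne

  commute : {π ρ : Perm6} → Commute (reify π) (reify ρ) → Commute (image π) (image ρ)
  commute {π} {ρ} eq = begin
    image π · image ρ   ≡⟨ sym (image-∘ π ρ) ⟩
    image (π ∘ₚ ρ)      ≡⟨ image-≡ (π ∘ₚ ρ) (ρ ∘ₚ π)
                             (trans (reify-∘ π ρ) (trans eq (sym (reify-∘ ρ π)))) ⟩
    image (ρ ∘ₚ π)      ≡⟨ image-∘ ρ π ⟩
    image ρ · image π   ∎

  all-involution : {n : ℕ} (πs : Vec Perm6 n) →
                   Allᵥ.All Involution (map reify πs) → Allᵥ.All Involution (map image πs)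
  all-involution πs h = map⁺ {f = image} (Allᵥ.map (λ {π} → involution {π}) (map⁻ {f = reify} h))

  coxeter : {n : ℕ} (πs : Vec Perm6 n) → Coxeter (map reify πs) → Coxeter (map image πs)
  coxeter []           _                 = tt
  coxeter (π ∷ [])     _                 = tt , tt
  coxeter (π ∷ ρ ∷ πs) ((b , cs) , rest) =
    (braid {π} {ρ} b , map⁺ {f = image} (Allᵥ.map (λ {κ} → commute {π} {κ}) (map⁻ {f = reify} cs)))
    , coxeter (ρ ∷ πs) rest

σ : Fin 5 → Perm6
σ i = transpose (inject₁ i) (suc i)

σs : Vec Perm6 5
σs = tabulate σ

transpositions : Vec Table 5
transpositions = map reify σs

reify-⟦⟧ : (w : List (Fin 5)) → reify (⟦ w ⟧ₚ σs) ≡ ⟦ w ⟧ transpositions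
reify-⟦⟧ w = Image.image-⟦⟧ id-monomorphism w σs

data Kind : Set where
  inner outer : Kind

-- standard outer lists ψ(s₀), …, ψ(s₄) for an outer automorphism ψ of Sym(6)
standard : Kind → Vec Table 5
standard inner = transpositions
standard outer =
  (# 1 ∷ # 0 ∷ # 3 ∷ # 2 ∷ # 5 ∷ # 4 ∷ []) ∷
  (# 4 ∷ # 2 ∷ # 1 ∷ # 5 ∷ # 0 ∷ # 3 ∷ []) ∷
  (# 1 ∷ # 0 ∷ # 5 ∷ # 4 ∷ # 3 ∷ # 2 ∷ []) ∷
  (# 4 ∷ # 5 ∷ # 3 ∷ # 2 ∷ # 0 ∷ # 1 ∷ []) ∷
  (# 1 ∷ # 0 ∷ # 4 ∷ # 5 ∷ # 2 ∷ # 3 ∷ []) ∷ []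

-- ⟦ lookup (route k) y ⟧ (standard k) maps 0 to y
route : Kind → Vec (List (Fin 5)) 6
route inner = [] ∷ (# 0 ∷ []) ∷ (# 0 ∷ # 1 ∷ []) ∷ (# 0 ∷ # 1 ∷ # 2 ∷ []) ∷
              (# 0 ∷ # 1 ∷ # 2 ∷ # 3 ∷ []) ∷ (# 0 ∷ # 1 ∷ # 2 ∷ # 3 ∷ # 4 ∷ []) ∷ []
route outer = [] ∷ (# 0 ∷ []) ∷ (# 0 ∷ # 1 ∷ []) ∷ (# 1 ∷ # 2 ∷ []) ∷
              (# 1 ∷ []) ∷ (# 0 ∷ # 3 ∷ []) ∷ []

abstract
  transpositions-involutions : Allᵥ.All Involution transpositions
  transpositions-involutions = by-evaluation (Allᵥ.all? involution? transpositions) refl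

  transpositions-coxeter : Coxeter transpositions
  transpositions-coxeter = by-evaluation (coxeter? transpositions) refl

-- Classification of Coxeter families of involutions

abstract
  involutions : List Table
  involutions = filter involution? (vectors 6)

  involution-∈ : {t : Table} → Involution t → t ∈ involutions
  involution-∈ {t} = ∈-filter⁺ involution? (∈-vectors t)

extensions : {n : ℕ} → List Table → Vec Table n → List (Vec Table (suc n))
extensions gens ts = List.map (_∷ ts) (filter (λ t → compatible? t ts) gens)

grow : {m : ℕ} → List Table → (n : ℕ) → List (Vec Table m) → List (Vec Table (n + m))
grow gens zero    seeds = seeds
grow gens (suc n) seeds = concatMap (extensions gens) (grow gens n seeds)

grow-complete : {m n : ℕ} (gens : List Table) (seeds : List (Vec Table m))
                (ts : Vec Table n) (us : Vec Table m) → us ∈ seeds →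
                Allᵥ.All (_∈ gens) ts → Coxeter (ts ++ᵥ us) → (ts ++ᵥ us) ∈ grow gens n seeds
grow-complete gens seeds []       us us∈ _                 _        = us∈
grow-complete gens seeds (t ∷ ts) us us∈ (t∈ Allᵥ.∷ ts∈) (c , cs) =
  ∈-concatMap⁺ (extensions gens)
    (lose (grow-complete gens seeds ts us us∈ ts∈ cs)
          (∈-map⁺ (_∷ (ts ++ᵥ us)) (∈-filter⁺ (λ t → compatible? t (ts ++ᵥ us)) t∈ c)))

canonicalInvolutions : List Table
canonicalInvolutions =
  (# 1 ∷ # 0 ∷ # 2 ∷ # 3 ∷ # 4 ∷ # 5 ∷ []) ∷
  (# 1 ∷ # 0 ∷ # 3 ∷ # 2 ∷ # 4 ∷ # 5 ∷ []) ∷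
  (# 1 ∷ # 0 ∷ # 3 ∷ # 2 ∷ # 5 ∷ # 4 ∷ []) ∷ []

canonicalFamilies : List (Vec Table 5)
canonicalFamilies = grow involutions 4 (List.map (_∷ []) canonicalInvolutions)

∈-canonicalFamilies : (T : Vec Table 5) → lookup T (# 4) ∈ canonicalInvolutions →
                      (∀ i → lookup T i ∈ involutions) → Coxeter T → T ∈ canonicalFamilies
∈-canonicalFamilies (t₀ ∷ t₁ ∷ t₂ ∷ t₃ ∷ t₄ ∷ []) t₄∈ listed coxeter =
  grow-complete involutions (List.map (_∷ []) canonicalInvolutions)
    (t₀ ∷ t₁ ∷ t₂ ∷ t₃ ∷ []) (t₄ ∷ []) (∈-map⁺ (_∷ []) t₄∈)
    (listed (# 0) Allᵥ.∷ listed (# 1) Allᵥ.∷ listed (# 2) Allᵥ.∷ listed (# 3) Allᵥ.∷ Allᵥ.[])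
    coxeter

-- r is determined by k and r 0, since it must map the route from 0 to y under
-- standard k onto the corresponding route under T
candidates : Vec Table 5 → List (Kind × Table)
candidates T = List.map (λ (k , a) → k , tabulate λ y → lookup (⟦ lookup (route k) y ⟧ T) a)
                        (cartesianProduct (inner ∷ outer ∷ []) (List.allFin 6))

Conjugator : Vec Table 5 → Kind × Table → Set
Conjugator T (k , r) = map (r ·_) T ≡ map (_· r) (standard k) × Bijective r

conjugator? : (T : Vec Table 5) (c : Kind × Table) → Dec (Conjugator T c)
conjugator? T (k , r) = ≡-dec _≟ᵛ_ (map (r ·_) T) (map (_· r) (standard k)) ×-dec bijective? r

abstract
  canonicalFamilies-conjugate : All (λ T → Any (Conjugator T) (candidates T)) canonicalFamilies
  canonicalFamilies-conjugate =
    by-evaluation (All.all? (λ T → Any.any? (conjugator? T) (candidates T)) canonicalFamilies) refl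

  -- lists the 2-cycles (x , t x), x < t x, of t and then its fixed points, so that
  -- conjugating the involution t by it gives a canonical involution
  arrangement : Table → Table
  arrangement t = tabulate λ i → fromMaybe i (List.head (List.drop (toℕ i) points))
    where
    points : List (Fin 6)
    points = concatMap (λ x → if isYes (x <? lookup t x) then x ∷ lookup t x ∷ [] else [])
                       (List.allFin 6)
             ++ filter (λ x → lookup t x ≟ x) (List.allFin 6)

Normalisable : Table → Set
Normalisable t =
  Bijective (arrangement t) × arrangement t · t · invert (arrangement t) ∈ canonicalInvolutions

abstract
  involutions-normalisable : All Normalisable involutions
  involutions-normalisable = by-evaluation
    (All.all? (λ t → bijective? (arrangement t) ×-dec
                     Any.any? (arrangement t · t · invert (arrangement t) ≟ᵛ_) canonicalInvolutions)
              involutions)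
    refl

record NormalForm (f : Perm6 → Perm6) : Set where
  field
    kind        : Kind
    ρ           : Perm6
    intertwines : ∀ w y → f (⟦ w ⟧ₚ σs) ⟨$⟩ʳ (ρ ⟨$⟩ʳ y) ≡ ρ ⟨$⟩ʳ lookup (⟦ w ⟧ (standard kind)) y

conjugator⇒intertwines : {T P : Vec Table 5} (r : Table) → map (r ·_) T ≡ map (_· r) P →
                         Intertwines (lookup r) T P
conjugator⇒intertwines {T} {P} r eq i y = begin
  lookup (lookup T i) (lookup r y)     ≡⟨ sym (lookup-· r (lookup T i) y) ⟩
  lookup (r · lookup T i) y            ≡⟨ cong (λ v → lookup v y) (sym (lookup-map i (r ·_) T)) ⟩
  lookup (lookup (map (r ·_) T) i) y   ≡⟨ cong (λ v → lookup (lookup v i) y) eq ⟩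
  lookup (lookup (map (_· r) P) i) y   ≡⟨ cong (λ v → lookup v y) (lookup-map i (_· r) P) ⟩
  lookup (lookup P i · r) y            ≡⟨ lookup-· (lookup P i) r y ⟩
  lookup r (lookup (lookup P i) y)     ∎
  where open ≡-Reasoning

canonical-normalForm : {f : Perm6 → Perm6} (mono : IsMonomorphism f) →
                       Image.image mono (σ (# 4)) ∈ canonicalInvolutions → NormalForm f
canonical-normalForm {f} mono σ₄∈ =
  fromConjugator (Any.satisfied (All.lookup canonicalFamilies-conjugate T∈))
  where
  open Image mono
  T = map image σs

  T∈ : T ∈ canonicalFamilies
  T∈ = ∈-canonicalFamilies T
         (subst (_∈ canonicalInvolutions) (sym (lookup-map (# 4) image σs)) σ₄∈)
         (λ i → involution-∈ (lookup⁺ (all-involution σs transpositions-involutions) i))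
         (coxeter σs transpositions-coxeter)

  fromConjugator : Σ (Kind × Table) (Conjugator T) → NormalForm f
  fromConjugator ((k , r) , eq , bij) = record
    { kind        = k
    ; ρ           = toPerm r bij
    ; intertwines = λ w y → begin
        f (⟦ w ⟧ₚ σs) ⟨$⟩ʳ lookup r y             ≡⟨ sym (lookup-reify (f (⟦ w ⟧ₚ σs)) (lookup r y)) ⟩
        lookup (image (⟦ w ⟧ₚ σs)) (lookup r y)   ≡⟨ cong (λ t → lookup t (lookup r y))
                                                       (image-⟦⟧ w σs) ⟩
        lookup (⟦ w ⟧ T) (lookup r y)             ≡⟨ intertwines-⟦⟧ {r = lookup r} {T} {standard k}
                                                       (conjugator⇒intertwines {T} r eq) w y ⟩
        lookup r (lookup (⟦ w ⟧ (standard k)) y)  ∎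
    }
    where open ≡-Reasoning

conjugate-normalForm : {f : Perm6 → Perm6} (ξ : Perm6) → NormalForm (conjugate ξ ∘ f) → NormalForm f
conjugate-normalForm ξ nf = record
  { kind        = kind
  ; ρ           = ρ ∘ₚ ξ
  ; intertwines = λ w y → trans (sym (inverseʳ ξ)) (cong (ξ ⟨$⟩ʳ_) (intertwines w y))
  }
  where open NormalForm nf

reify-conjugate : (r : Table) (bij : Bijective r) (π : Perm6) →
                  reify (conjugate (toPerm r bij) π) ≡ r · reify π · invert r
reify-conjugate r bij π = trans (reify-∘₃ ξ π (flip ξ))
  (cong₂ (λ u v → u · reify π · v) (tabulate∘lookup r) (tabulate∘lookup (invert r)))
  where ξ = toPerm r bij

-- Conjugating f first, so that the image of s₄ is canonical, cuts the enumeration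
-- down to the Coxeter families whose last member is a canonical involution.
normalForm : {f : Perm6 → Perm6} → IsMonomorphism f → NormalForm f
normalForm {f} mono = normalise (All.lookup involutions-normalisable (involution-∈ σ₄-involution))
  where
  open Image mono
  σ₄-involution : Involution (image (σ (# 4)))
  σ₄-involution = involution {σ (# 4)} (lookup⁺ transpositions-involutions (# 4))

  normalise : Normalisable (image (σ (# 4))) → NormalForm f
  normalise (bij , canonical) = conjugate-normalForm ξ
    (canonical-normalForm (conjugate-monomorphism ξ mono)
      (subst (_∈ canonicalInvolutions)
        (sym (reify-conjugate (arrangement (image (σ (# 4)))) bij (f (σ (# 4))))) canonical))
    where ξ = toPerm (arrangement (image (σ (# 4)))) bij

-- Colourings of the standard models

Colouring : ℕ → Set
Colouring k = Vec (Fin k) 6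

-- the transposition (i j), i < j, as sᵢ sᵢ₊₁ ⋯ sⱼ₋₁ ⋯ sᵢ₊₁ sᵢ
transpositionWords : List (List (Fin 5))
transpositionWords =
  (# 0 ∷ []) ∷ (# 0 ∷ # 1 ∷ # 0 ∷ []) ∷ (# 0 ∷ # 1 ∷ # 2 ∷ # 1 ∷ # 0 ∷ []) ∷
  (# 0 ∷ # 1 ∷ # 2 ∷ # 3 ∷ # 2 ∷ # 1 ∷ # 0 ∷ []) ∷
  (# 0 ∷ # 1 ∷ # 2 ∷ # 3 ∷ # 4 ∷ # 3 ∷ # 2 ∷ # 1 ∷ # 0 ∷ []) ∷
  (# 1 ∷ []) ∷ (# 1 ∷ # 2 ∷ # 1 ∷ []) ∷ (# 1 ∷ # 2 ∷ # 3 ∷ # 2 ∷ # 1 ∷ []) ∷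
  (# 1 ∷ # 2 ∷ # 3 ∷ # 4 ∷ # 3 ∷ # 2 ∷ # 1 ∷ []) ∷
  (# 2 ∷ []) ∷ (# 2 ∷ # 3 ∷ # 2 ∷ []) ∷ (# 2 ∷ # 3 ∷ # 4 ∷ # 3 ∷ # 2 ∷ []) ∷
  (# 3 ∷ []) ∷ (# 3 ∷ # 4 ∷ # 3 ∷ []) ∷ (# 4 ∷ []) ∷ []

twoTranspositionWords : List (List (Fin 5))
twoTranspositionWords = cartesianProductWith _++_ transpositionWords transpositionWords

NontrivialEven : List (Fin 5) → Set
NontrivialEven w = ⟦ w ⟧ transpositions ≢ ι × Even (⟦ w ⟧ₚ σs)

nontrivialEven? : (w : List (Fin 5)) → Dec (NontrivialEven w)
nontrivialEven? w = ¬? (⟦ w ⟧ transpositions ≟ᵛ ι) ×-dec (2 ∣? inversions (⟦ w ⟧ₚ σs))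

Witness : Kind → Colouring 2 → Colouring 2 → List (Fin 5) → Set
Witness k a b w = (⟦ w ⟧ (standard k) · b ≡ b × ⟦ w ⟧ transpositions · a ≡ a) × NontrivialEven w

EvaluatedWord : Set
EvaluatedWord = List (Fin 5) × Table × Table

evaluate : Kind → List (Fin 5) → EvaluatedWord
evaluate k w = w , ⟦ w ⟧ transpositions , ⟦ w ⟧ (standard k)

witnessCandidates : Kind → List EvaluatedWord
witnessCandidates k = List.map (evaluate k) (filter nontrivialEven? twoTranspositionWords)

-- filtering per colouring a, and passing lists as arguments, lets the
-- evaluator share the tables between the 64 × 64 cases
Covering : List EvaluatedWord → Set
Covering ss = All (λ a → All (λ b → Any (λ (_ , _ , u) → u · b ≡ b)
                                       (filter (λ (_ , t , _) → t · a ≟ᵛ a) ss))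
                             (vectors {2} 6))
                  (vectors {2} 6)

covering? : (ss : List EvaluatedWord) → Dec (Covering ss)
covering? ss = All.all? (λ a → covers (filter (λ (_ , t , _) → t · a ≟ᵛ a) ss)) (vectors {2} 6)
  where
  covers : (ss : List EvaluatedWord) →
           Dec (All (λ b → Any (λ (_ , _ , u) → u · b ≡ b) ss) (vectors {2} 6))
  covers ss = All.all? (λ b → Any.any? (λ (_ , _ , u) → u · b ≟ᵛ b) ss) (vectors {2} 6)

abstract
  witnessCandidates-cover : ∀ k → Covering (witnessCandidates k)
  witnessCandidates-cover inner = by-evaluation (covering? (witnessCandidates inner)) refl
  witnessCandidates-cover outer = by-evaluation (covering? (witnessCandidates outer)) refl

witness : ∀ k a b → ∃ (Witness k a b)
witness k a b =
  Any.satisfied (filter⁻ nontrivialEven? {twoTranspositionWords}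
    (Anyₚ.map⁻ {f = evaluate k} {xs = filter nontrivialEven? twoTranspositionWords}
      (filter⁻ (λ (_ , t , _) → t · a ≟ᵛ a) {witnessCandidates k}
        (All.lookup (All.lookup (witnessCandidates-cover k) (∈-vectors a)) (∈-vectors b)))))

χ : Colouring 3
χ = # 2 ∷ # 2 ∷ # 0 ∷ # 0 ∷ # 1 ∷ # 1 ∷ []

β : Kind → Colouring 3
β inner = # 0 ∷ # 1 ∷ # 0 ∷ # 1 ∷ # 0 ∷ # 1 ∷ []
β outer = # 0 ∷ # 1 ∷ # 0 ∷ # 0 ∷ # 0 ∷ # 1 ∷ []

-- ⟨s₀, s₂, s₄⟩, the stabiliser of χ
stabiliserWords : List (List (Fin 5))
stabiliserWords =
  [] ∷ (# 0 ∷ []) ∷ (# 2 ∷ []) ∷ (# 4 ∷ []) ∷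
  (# 0 ∷ # 2 ∷ []) ∷ (# 0 ∷ # 4 ∷ []) ∷ (# 2 ∷ # 4 ∷ []) ∷ (# 0 ∷ # 2 ∷ # 4 ∷ []) ∷ []

sameColour : {k : ℕ} → Colouring k → Fin 6 → List (Fin 6)
sameColour c i = filter (λ y → lookup c y ≟ lookup c i) (List.allFin 6)

preservers : {k : ℕ} → Colouring k → List Table
preservers c = choices (tabulate (sameColour c))

∈-preservers : {k : ℕ} {c : Colouring k} {t : Table} → t · c ≡ c → t ∈ preservers c
∈-preservers {c = c} {t} eq = ∈-choices t (tabulate (sameColour c)) λ i →
  subst (lookup t i ∈_) (sym (lookup∘tabulate (sameColour c) i))
    (∈-filter⁺ (λ y → lookup c y ≟ lookup c i) (∈-allFin (lookup t i))
      (trans (sym (lookup-· t c i)) (cong (λ c′ → lookup c′ i) eq)))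

InjectiveTable : Table → Set
InjectiveTable t = ∀ x y → lookup t x ≡ lookup t y → x ≡ y

injective? : (t : Table) → Dec (InjectiveTable t)
injective? t = all? λ x → all? λ y → (lookup t x ≟ lookup t y) →-dec (x ≟ y)

StabiliserWord : Kind → Table → List (Fin 5) → Set
StabiliserWord k t w = ⟦ w ⟧ transpositions ≡ t × (⟦ w ⟧ (standard k) · β k ≡ β k → t ≡ ι)

StabiliserElement : Kind → Table → Set
StabiliserElement k t = Any (StabiliserWord k t) stabiliserWords

stabiliserElement? : ∀ k t → Dec (StabiliserElement k t)
stabiliserElement? k t = Any.any? (λ w → (⟦ w ⟧ transpositions ≟ᵛ t) ×-dec
                                         ((⟦ w ⟧ (standard k) · β k ≟ᵛ β k) →-dec (t ≟ᵛ ι)))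
                                  stabiliserWords

abstract
  χ-stabiliser : ∀ k → All (λ t → InjectiveTable t → StabiliserElement k t) (preservers χ)
  χ-stabiliser inner = by-evaluation
    (All.all? (λ t → injective? t →-dec stabiliserElement? inner t) (preservers χ)) refl
  χ-stabiliser outer = by-evaluation
    (All.all? (λ t → injective? t →-dec stabiliserElement? outer t) (preservers χ)) refl

  β-avoids-2 : ∀ k y → lookup (β k) y ≢ # 2
  β-avoids-2 inner = by-evaluation (all? λ y → ¬? (lookup (β inner) y ≟ # 2)) refl
  β-avoids-2 outer = by-evaluation (all? λ y → ¬? (lookup (β outer) y ≟ # 2)) refl

-- Colourings of K₆,₆

Preserves : {C : Set} → (V → C) → AutΓ → Set
Preserves c g = ∀ v → c (app g v) ≡ c v

distinguishing-∘ : {G : AutΓ → Set} {m n : ℕ} {c : V → Fin m} (f : Fin m → Fin n) →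
                   (∀ {x y} → f x ≡ f y → x ≡ y) → Distinguishing G c → Distinguishing G (f ∘ c)
distinguishing-∘ f f-injective dist g g∈G preserves = dist g g∈G (λ v → f-injective (preserves v))

-- g maps Δ′, the neighbourhood of a vertex of Δ, onto a neighbourhood
parts-preserved : (g : AutΓ) (j : Fin 6) → side (app g (inj₁ j)) ≡ true → PreservesParts g
parts-preserved g j g-j∈Δ = preserves
  where
  Δ-neighbour : ∀ u w → side u ≡ true → Adj u w → side w ≡ false
  Δ-neighbour (inj₁ _) (inj₂ _) _  _ = refl
  Δ-neighbour (inj₂ _) _        () _
  Δ′-neighbour : ∀ u w → side w ≡ false → Adj u w → side u ≡ true
  Δ′-neighbour (inj₁ _) _        _  _ = refl
  Δ′-neighbour (inj₂ _) (inj₁ _) () _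
  preserves-Δ′ : ∀ k → side (app g (inj₂ k)) ≡ false
  preserves-Δ′ k =
    Δ-neighbour (app g (inj₁ j)) (app g (inj₂ k)) g-j∈Δ (AutΓ.adj⇒ g (inj₁ j) (inj₂ k) tt)
  preserves : PreservesParts g
  preserves (inj₁ i) =
    Δ′-neighbour (app g (inj₁ i)) (app g (inj₂ j)) (preserves-Δ′ j)
      (AutΓ.adj⇒ g (inj₁ i) (inj₂ j) tt)
  preserves (inj₂ k) = preserves-Δ′ k

even⇒HSub : (c : HChoice) (π : Perm6) → Even π → HSub c π
even⇒HSub alt         _ even = even
even⇒HSub HChoice.sym _ _    = tt

module Diagonal {φ : Perm6 → Perm6} (mono : IsMonomorphism φ) (G : AutΓ → Set) (c : HChoice) where
  open IsMonomorphism mono using (resp-≈; identity)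
  open NormalForm (normalForm mono)
  open ≡-Reasoning

  glue : {C : Set} → Vec C 6 → Vec C 6 → V → C
  glue a b (inj₁ j) = lookup a j
  glue a b (inj₂ j) = lookup b (ρ ⟨$⟩ˡ j)

  ⟦⟧ₚ-lookup : ∀ w j → ⟦ w ⟧ₚ σs ⟨$⟩ʳ j ≡ lookup (⟦ w ⟧ transpositions) j
  ⟦⟧ₚ-lookup w j = trans (sym (lookup-reify (⟦ w ⟧ₚ σs) j)) (cong (λ t → lookup t j) (reify-⟦⟧ w))

  actsAs-resp : {g : AutΓ} {π π′ : Perm6} → π ≈ₚ π′ → ActsAs φ g π → ActsAs φ g π′
  actsAs-resp eq acts j =
    trans (proj₁ (acts j)) (cong inj₁ (eq j)) , trans (proj₂ (acts j)) (cong inj₂ (resp-≈ eq j))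

  preserves⇒stableΔ : {C : Set} {a b : Vec C 6} {g : AutΓ} {π : Perm6} →
                      ActsAs φ g π → Preserves (glue a b) g → reify π · a ≡ a
  preserves⇒stableΔ {a = a} {b} {g} {π} acts preserves = lookup-ext λ j → begin
    lookup (reify π · a) j          ≡⟨ lookup-· (reify π) a j ⟩
    lookup a (lookup (reify π) j)   ≡⟨ cong (lookup a) (lookup-reify π j) ⟩
    glue a b (inj₁ (π ⟨$⟩ʳ j))      ≡⟨ cong (glue a b) (sym (proj₁ (acts j))) ⟩
    glue a b (app g (inj₁ j))       ≡⟨ preserves (inj₁ j) ⟩
    lookup a j                      ∎

  preserves⇒stableΔ′ : {C : Set} {a b : Vec C 6} {g : AutΓ} (w : List (Fin 5)) →
                       ActsAs φ g (⟦ w ⟧ₚ σs) → Preserves (glue a b) g →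
                       ⟦ w ⟧ (standard kind) · b ≡ b
  preserves⇒stableΔ′ {a = a} {b} {g} w acts preserves = lookup-ext λ y → begin
    lookup (P · b) y                       ≡⟨ lookup-· P b y ⟩
    lookup b (lookup P y)                  ≡⟨ cong (lookup b) (sym (inverseˡ ρ)) ⟩
    glue a b (inj₂ (ρ ⟨$⟩ʳ lookup P y))    ≡⟨ cong (glue a b ∘ inj₂) (sym (intertwines w y)) ⟩
    glue a b (inj₂ (W ⟨$⟩ʳ (ρ ⟨$⟩ʳ y)))    ≡⟨ cong (glue a b) (sym (proj₂ (acts (ρ ⟨$⟩ʳ y)))) ⟩
    glue a b (app g (inj₂ (ρ ⟨$⟩ʳ y)))     ≡⟨ preserves (inj₂ (ρ ⟨$⟩ʳ y)) ⟩
    lookup b (ρ ⟨$⟩ˡ (ρ ⟨$⟩ʳ y))            ≡⟨ cong (lookup b) (inverseˡ ρ) ⟩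
    lookup b y                             ∎
    where
    W = φ (⟦ w ⟧ₚ σs)
    P = ⟦ w ⟧ (standard kind)

  stable⇒preserves : {C : Set} {a b : Vec C 6} {g : AutΓ} (w : List (Fin 5)) →
                     ActsAs φ g (⟦ w ⟧ₚ σs) → ⟦ w ⟧ transpositions · a ≡ a →
                     ⟦ w ⟧ (standard kind) · b ≡ b → Preserves (glue a b) g
  stable⇒preserves {a = a} {b} {g} w acts stable-a stable-b (inj₁ j) = begin
    glue a b (app g (inj₁ j))                    ≡⟨ cong (glue a b) (proj₁ (acts j)) ⟩
    lookup a (⟦ w ⟧ₚ σs ⟨$⟩ʳ j)                  ≡⟨ cong (lookup a) (⟦⟧ₚ-lookup w j) ⟩
    lookup a (lookup (⟦ w ⟧ transpositions) j)   ≡⟨ sym (lookup-· (⟦ w ⟧ transpositions) a j) ⟩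
    lookup (⟦ w ⟧ transpositions · a) j          ≡⟨ cong (λ c′ → lookup c′ j) stable-a ⟩
    lookup a j                                   ∎
  stable⇒preserves {a = a} {b} {g} w acts stable-a stable-b (inj₂ j) = begin
    glue a b (app g (inj₂ j))                   ≡⟨ cong (glue a b) (proj₂ (acts j)) ⟩
    lookup b (ρ ⟨$⟩ˡ (W ⟨$⟩ʳ j))                ≡⟨ cong (λ x → lookup b (ρ ⟨$⟩ˡ (W ⟨$⟩ʳ x)))
                                                     (sym (inverseʳ ρ)) ⟩
    lookup b (ρ ⟨$⟩ˡ (W ⟨$⟩ʳ (ρ ⟨$⟩ʳ y)))       ≡⟨ cong (λ x → lookup b (ρ ⟨$⟩ˡ x)) (intertwines w y) ⟩
    lookup b (ρ ⟨$⟩ˡ (ρ ⟨$⟩ʳ lookup P y))       ≡⟨ cong (lookup b) (inverseˡ ρ) ⟩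
    lookup b (lookup P y)                       ≡⟨ sym (lookup-· P b y) ⟩
    lookup (P · b) y                            ≡⟨ cong (λ c′ → lookup c′ y) stable-b ⟩
    lookup b y                                  ∎
    where
    y = ρ ⟨$⟩ˡ j
    W = φ (⟦ w ⟧ₚ σs)
    P = ⟦ w ⟧ (standard kind)

  no-distinguishing-2-colouring : (∀ h → HSub c h → Σ AutΓ λ g → G g × ActsAs φ g h) →
                                  (col : V → Fin 2) → ¬ Distinguishing G col
  no-distinguishing-2-colouring diag₂ col dist = refute (witness kind a b)
    where
    a b : Colouring 2
    a = tabulate (col ∘ inj₁)
    b = tabulate (λ y → col (inj₂ (ρ ⟨$⟩ʳ y)))

    glue≗col : ∀ v → glue a b v ≡ col v
    glue≗col (inj₁ j) = lookup∘tabulate (col ∘ inj₁) j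
    glue≗col (inj₂ j) =
      trans (lookup∘tabulate (λ y → col (inj₂ (ρ ⟨$⟩ʳ y))) (ρ ⟨$⟩ˡ j))
            (cong (col ∘ inj₂) (inverseʳ ρ))

    refute : ∃ (Witness kind a b) → ⊥
    refute (w , (stable-b , stable-a) , nontrivial , even) =
      fixed (diag₂ (⟦ w ⟧ₚ σs) (even⇒HSub c (⟦ w ⟧ₚ σs) even))
      where
      fixed : (Σ AutΓ λ g → G g × ActsAs φ g (⟦ w ⟧ₚ σs)) → ⊥
      fixed (g , g∈G , acts) = nontrivial (lookup-ext λ j → begin
        lookup (⟦ w ⟧ transpositions) j   ≡⟨ sym (⟦⟧ₚ-lookup w j) ⟩
        ⟦ w ⟧ₚ σs ⟨$⟩ʳ j                  ≡⟨ inj₁-injective (trans (sym (proj₁ (acts j)))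
                                               (dist g g∈G preserved (inj₁ j))) ⟩
        j                                 ≡⟨ sym (lookup-allFin j) ⟩
        lookup ι j                        ∎)
        where
        preserved : Preserves col g
        preserved v = trans (sym (glue≗col (app g v)))
          (trans (stable⇒preserves {a = a} {b} {g} w acts stable-a stable-b v) (glue≗col v))

  three-colouring : (∀ g → G g → PreservesParts g → Σ Perm6 λ h → HSub c h × ActsAs φ g h) →
                    HasDistPartition G 3
  three-colouring diag₁ = glue χ (β kind) , surjective , distinguishing
    where
    surjective : Surjective _≡_ _≡_ (glue χ (β kind))
    surjective zero             = inj₁ (# 2) , λ { refl → refl }
    surjective (suc zero)       = inj₁ (# 4) , λ { refl → refl }
    surjective (suc (suc zero)) = inj₁ (# 0) , λ { refl → refl }

    colour-2-in-Δ : (v : V) → glue χ (β kind) v ≡ # 2 → side v ≡ true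
    colour-2-in-Δ (inj₁ _) _   = refl
    colour-2-in-Δ (inj₂ k) two = ⊥-elim (β-avoids-2 kind (ρ ⟨$⟩ˡ k) two)

    distinguishing : Distinguishing G (glue χ (β kind))
    distinguishing g g∈G preserves =
      fixed (diag₁ g g∈G (parts-preserved g zero
        (colour-2-in-Δ (app g (inj₁ zero)) (preserves (inj₁ zero)))))
      where
      fixed : (Σ Perm6 λ h → HSub c h × ActsAs φ g h) → ∀ v → app g v ≡ v
      fixed (h , _ , acts) = fixes (Any.satisfied stabiliser)
        where
        h-injective : InjectiveTable (reify h)
        h-injective x y eq = trans (sym (inverseˡ h))
          (trans (cong (h ⟨$⟩ˡ_) (trans (sym (lookup-reify h x)) (trans eq (lookup-reify h y))))
                 (inverseˡ h))

        stabiliser : StabiliserElement kind (reify h)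
        stabiliser = All.lookup (χ-stabiliser kind)
          (∈-preservers {c = χ} {reify h}
            (preserves⇒stableΔ {a = χ} {β kind} {g} {h} acts preserves))
          h-injective

        fixes : ∃ (StabiliserWord kind (reify h)) → ∀ v → app g v ≡ v
        fixes (w , w≡h , trivial) = λ
          { (inj₁ j) → trans (proj₁ (acts j)) (cong inj₁ (h≈id j))
          ; (inj₂ j) → trans (proj₂ (acts j)) (cong inj₂ (trans (resp-≈ h≈id j) (identity j)))
          }
          where
          h≈w : h ≈ₚ ⟦ w ⟧ₚ σs
          h≈w = reify-injective {h} {⟦ w ⟧ₚ σs} (trans (sym w≡h) (sym (reify-⟦⟧ w)))
          h≈id : h ≈ₚ idₚ
          h≈id = reify-injective {h} {idₚ}
            (trivial (preserves⇒stableΔ′ {a = χ} {β kind} {g} w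
              (actsAs-resp {g} {h} h≈w acts) preserves))

proposition3p2 : (G : AutΓ → Set) → IsSubgroup G →
    VertexTransitive G → EdgeTransitive G →
    (c : HChoice) → (φ : Perm6 → Perm6) → OuterInvolution φ →
    PlusIsDiag G φ (HSub c) →
    DistNumberIs G 3
proposition3p2 G _ _ _ c φ oi (diag₁ , diag₂) =
  three-colouring diag₁ , λ m m<3 (col , _ , dist) →
    no-distinguishing-2-colouring diag₂ (λ v → inject≤ (col v) (s≤s⁻¹ m<3))
      (distinguishing-∘ (λ x → inject≤ x (s≤s⁻¹ m<3))
        (λ {x} {y} → inject≤-injective (s≤s⁻¹ m<3) (s≤s⁻¹ m<3) x y) dist)
  where open Diagonal (outerInvolution⇒monomorphism oi) G c
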